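{- Let $\mathcal{C}(\widetilde{D}_8)$ be the point-line incidence structure with points $0,\dots,8$ and lines $\{0,2\},\{1,2\},\{2,3\},\{3,4\},\{4,5\},\{5,6\},\{6,7\},\{6,8\}$. Then its Veldkamp space has $105$ points (geometric hyperplanes) and $876$ three-point Veldkamp lines. It contains a $\mathrm{PG}(5,2)$, formed by the $63$ hyperplanes containing $\{2,4,6\}$, which is its maximum projective subspace, and a $\mathrm{PG}(4,2)$, formed by the hyperplanes containing $\{2,3,5,6\}$; these two intersect in the $\mathrm{PG}(3,2)$ formed by the $15$ hyperplanes containing $\{2,3,4,5,6\}$.
   Context: A geometric hyperplane is a proper subset $H$ of the point set such that every line is either contained in $H$ or meets $H$ in exactly one point. A three-point Veldkamp line is a set $\{H_1,H_2,H_3\}$ of three distinct geometric hyperplanes with $H_3$ the complement of $H_1\triangle H_2$ in the point set. A set $S$ of hyperplanes "forms $\mathrm{PG}(d,2)$" (is a projective subspace) if $S$ together with all three-point Veldkamp lines contained in $S$ is isomorphic to the $d$-dimensional projective space over $\mathrm{GF}(2)$. -}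

module Defs where

open import Data.Nat using (ℕ; suc)
open import Data.Bool using (Bool; _xor_)
open import Data.Fin using (Fin; #_)
open import Data.Fin.Subset using (Subset; ⊤; ⊥; ⁅_⁆; _∪_; _∩_; ∁; _⊆_; ∣_∣)
open import Data.Vec using (Vec; zipWith)
open import Data.List using (List; []; _∷_; length)
open import Data.List.Relation.Unary.AllPairs using (AllPairs)
import Data.List.Membership.Propositional as LMem
open import Data.Product using (Σ; _×_; _,_)
open import Data.Sum using (_⊎_)
open import Relation.Binary.PropositionalEquality using (_≡_; _≢_)
open import Relation.Nullary using (¬_)
open import Function.Bundles using (_⇔_)
open import Function.Definitions using (Injective)

_Δ_ : ∀ {n} → Subset n → Subset n → Subset n
_Δ_ = zipWith _xor_

IsHyperplane : ∀ {n} → List (Subset n) → Subset n → Set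
IsHyperplane {n} lines H =
  (H ≢ ⊤) × (∀ L → L LMem.∈ lines → (L ⊆ H) ⊎ (∣ H ∩ L ∣ ≡ 1))

IsVeldkampLine : ∀ {n} → List (Subset n) → Subset n → Subset n → Subset n → Set
IsVeldkampLine lines H₁ H₂ H₃ =
  IsHyperplane lines H₁ × IsHyperplane lines H₂ × IsHyperplane lines H₃ ×
  (H₁ ≢ H₂) × (H₁ ≢ H₃) × (H₂ ≢ H₃) × (H₃ ≡ ∁ (H₁ Δ H₂))

_∈[_]_ : ∀ {A : Set} → A → (A → A → Set) → List A → Set
x ∈[ _≈_ ] xs = Σ _ λ y → (y LMem.∈ xs) × (x ≈ y)

HasSizeUpTo : ∀ {A : Set} → (A → A → Set) → (A → Set) → ℕ → Set
HasSizeUpTo {A} _≈_ P k =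
  Σ (List A) λ xs →
    AllPairs (λ x y → ¬ (x ≈ y)) xs ×
    (∀ x → x LMem.∈ xs → P x) ×
    (∀ x → P x → x ∈[ _≈_ ] xs) ×
    (length xs ≡ k)

HasSize : ∀ {A : Set} → (A → Set) → ℕ → Set
HasSize = HasSizeUpTo _≡_

-- unordered triples: two triples are equal iff they have the same elements
Triple : ∀ {n} → Set
Triple {n} = Subset n × Subset n × Subset n

_∈₃_ : ∀ {n} → Subset n → Triple {n} → Set
H ∈₃ (a , b , c) = (H ≡ a) ⊎ (H ≡ b) ⊎ (H ≡ c)

SameSet₃ : ∀ {n} → Triple {n} → Triple {n} → Set
SameSet₃ {n} t t' = ∀ (H : Subset n) → (H ∈₃ t) ⇔ (H ∈₃ t')

NumVeldkampLines : ∀ {n} → List (Subset n) → ℕ → Set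
NumVeldkampLines lines k =
  HasSizeUpTo SameSet₃ (λ { (a , b , c) → IsVeldkampLine lines a b c }) k

-- PG(d,2): points are the nonzero vectors of GF(2)^(d+1) (Subset (suc d),
-- with ⊥ the zero vector), lines are {u, v, u+v}.

FormsPG : ∀ {n} → List (Subset n) → ℕ → (Subset n → Set) → Set
FormsPG {n} lines d S =
  Σ (Subset (suc d) → Subset n) λ f →
    (∀ u → u ≢ ⊥ → S (f u)) ×
    (∀ H → S H → Σ (Subset (suc d)) λ u → (u ≢ ⊥) × (f u ≡ H)) ×
    (∀ u v → u ≢ ⊥ → v ≢ ⊥ → f u ≡ f v → u ≡ v) ×
    (∀ u v → u ≢ ⊥ → v ≢ ⊥ → u ≢ v →
       IsVeldkampLine lines (f u) (f v) (f (u Δ v))) ×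
    (∀ u v w → u ≢ ⊥ → v ≢ ⊥ → w ≢ ⊥ →
       IsVeldkampLine lines (f u) (f v) (f w) → w ≡ u Δ v)

line : Fin 9 → Fin 9 → Subset 9
line a b = ⁅ a ⁆ ∪ ⁅ b ⁆

D8lines : List (Subset 9)
D8lines =
  line (# 0) (# 2) ∷ line (# 1) (# 2) ∷ line (# 2) (# 3) ∷ line (# 3) (# 4) ∷
  line (# 4) (# 5) ∷ line (# 5) (# 6) ∷ line (# 6) (# 7) ∷ line (# 6) (# 8) ∷ []

Hyp : Subset 9 → Set
Hyp = IsHyperplane D8lines

A₂₄₆ A₂₃₅₆ A₂₃₄₅₆ : Subset 9
A₂₄₆ = ⁅ # 2 ⁆ ∪ ⁅ # 4 ⁆ ∪ ⁅ # 6 ⁆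
A₂₃₅₆ = ⁅ # 2 ⁆ ∪ ⁅ # 3 ⁆ ∪ ⁅ # 5 ⁆ ∪ ⁅ # 6 ⁆
A₂₃₄₅₆ = ⁅ # 2 ⁆ ∪ ⁅ # 3 ⁆ ∪ ⁅ # 4 ⁆ ∪ ⁅ # 5 ⁆ ∪ ⁅ # 6 ⁆

HypsContaining : Subset 9 → Subset 9 → Set
HypsContaining A H = Hyp H × (A ⊆ H)

-- Everything finite is settled by enumerating the 2⁹ subsets of points. A Veldkamp line is
-- an unordered triple, so the lines are listed once each through their rank-sorted
-- representatives; that this list is strictly increasing is a linear check and gives
-- distinctness up to reordering. Each of the sets A = {2,4,6}, {2,3,5,6}, {2,3,4,5,6} meets
-- every line, so the hyperplanes containing A are exactly the complements ∁u of the nonzero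
-- vectors u of GF(2)⁹ supported off A, and the third point of the Veldkamp line through ∁u
-- and ∁v is ∁(u + v): they form PG(|∁A| − 1, 2). Finally a PG(d,2) of hyperplanes has
-- 2^(d+1) − 1 distinct points, and 127 > 105 rules out d ≥ 6.
module Submission where

open import Defs
open import Data.Nat using (ℕ; _≤_)
open import Data.Fin.Subset using (Subset)
open import Data.Product using (_×_)
open import Function.Bundles using (_⇔_)

import Algebra.Lattice.Properties.BooleanAlgebra as BooleanAlgebra
open import Data.Bool using (true; false; not; _xor_)
open import Data.Bool.Properties
  using (xor-comm; xor-assoc; xor-identityˡ; xor-identityʳ; xor-same) renaming (_≟_ to _≟ᵇ_)
open import Data.Fin using (Fin; zero; suc)
open import Data.Fin.Properties using (injective⇒≤)
open import Data.Fin.Subset using (⊥; ⊤; ∁; _∪_; _∩_; _⊆_; ∣_∣; inside; outside)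
open import Data.Fin.Subset.Properties
  using (_⊆?_; ⊆-trans; p⊆p∪q; q⊆p∪q; x∈p∪q⁻; drop-∷-⊆; ∪-∩-booleanAlgebra)
open import Data.List using (List; []; _∷_; filter; length; lookup; map; cartesianProduct; cartesianProductWith)
open import Data.List.Membership.Propositional using (_∈_)
open import Data.List.Membership.Propositional.Properties
  using (∈-filter⁺; ∈-filter⁻; ∈-map⁺; ∈-lookup; ∈-cartesianProduct⁺; ∈-cartesianProductWith⁺)
import Data.List.Membership.Setoid.Properties as SetoidMembership
open import Data.List.Relation.Unary.All as All using (all?; []; _∷_)
open import Data.List.Relation.Unary.AllPairs as AllPairs using ([]; _∷_)
import Data.List.Relation.Unary.Any as Any
open import Data.List.Relation.Unary.Linked using (Linked; linked?)
open import Data.List.Relation.Unary.Linked.Properties using (Linked⇒AllPairs)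
open import Data.List.Relation.Unary.Unique.Propositional using (Unique)
import Data.List.Relation.Unary.Unique.Propositional.Properties as Unique
open import Data.Nat as ℕ using (zero; suc; _+_; _*_; _^_; _<_; s≤s; z≤n)
open import Data.Nat.Properties
  using (*-cancelˡ-≡; suc-injective; even≢odd; <-cmp; <-irrefl; <-trans; <⇒≤; ≤-refl; ≤-antisym; ≰⇒>)
open import Data.Product using (∃-syntax; _,_; proj₁; proj₂)
open import Data.Sum as Sum using (inj₁; inj₂; [_,_]′)
open import Data.Vec using ([]; _∷_; padRight; here)
import Data.Vec.Properties as Vec
open import Function using (_∘_)
open import Function.Bundles using (mk⇔; Equivalence)
open import Function.Definitions using (Injective)
import Function.Properties.Equivalence as ⇔
open import Relation.Binary.Definitions using (DecidableEquality; tri<; tri≈; tri>)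
open import Relation.Binary.PropositionalEquality
open import Relation.Nullary using (¬_; Dec; yes; no; ¬?; contradiction)
open import Relation.Nullary.Decidable using (map′; _×-dec_; _⊎-dec_; _→-dec_; from-yes; from-no)
open import Relation.Unary using (Decidable)
open ≡-Reasoning

private variable n : ℕ

-- Subsets as vectors of GF(2)ⁿ

Δ-comm : (p q : Subset n) → p Δ q ≡ q Δ p
Δ-comm = Vec.zipWith-comm xor-comm

Δ-assoc : (p q r : Subset n) → (p Δ q) Δ r ≡ p Δ (q Δ r)
Δ-assoc = Vec.zipWith-assoc xor-assoc

Δ-identityˡ : (p : Subset n) → ⊥ Δ p ≡ p
Δ-identityˡ = Vec.zipWith-identityˡ xor-identityˡ

Δ-identityʳ : (p : Subset n) → p Δ ⊥ ≡ p
Δ-identityʳ = Vec.zipWith-identityʳ xor-identityʳ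

Δ-self : (p : Subset n) → p Δ p ≡ ⊥
Δ-self []      = refl
Δ-self (x ∷ p) = cong₂ _∷_ (xor-same x) (Δ-self p)

Δ-cancelˡ : (p q : Subset n) → p Δ (p Δ q) ≡ q
Δ-cancelˡ p q = begin
  p Δ (p Δ q) ≡⟨ Δ-assoc p p q ⟨
  (p Δ p) Δ q ≡⟨ cong (_Δ q) (Δ-self p) ⟩
  ⊥ Δ q       ≡⟨ Δ-identityˡ q ⟩
  q           ∎

Δ≡⊥⇒≡ : (p q : Subset n) → p Δ q ≡ ⊥ → p ≡ q
Δ≡⊥⇒≡ p q eq = begin
  p           ≡⟨ Δ-identityʳ p ⟨
  p Δ ⊥       ≡⟨ cong (p Δ_) eq ⟨
  p Δ (p Δ q) ≡⟨ Δ-cancelˡ p q ⟩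
  q           ∎

≡Δ⇒≡⊥ : (p q : Subset n) → p ≡ p Δ q → q ≡ ⊥
≡Δ⇒≡⊥ p q eq = begin
  q           ≡⟨ Δ-cancelˡ p q ⟨
  p Δ (p Δ q) ≡⟨ cong (p Δ_) eq ⟨
  p Δ p       ≡⟨ Δ-self p ⟩
  ⊥           ∎

∁-Δ-∁ : (p q : Subset n) → ∁ p Δ ∁ q ≡ p Δ q
∁-Δ-∁ []      []      = refl
∁-Δ-∁ (x ∷ p) (y ∷ q) = cong₂ _∷_ (bit x y) (∁-Δ-∁ p q)
  where
  bit : ∀ x y → not x xor not y ≡ x xor y
  bit false false = refl
  bit false true  = refl
  bit true  false = refl
  bit true  true  = refl

∁-Δ-∁-Δ : (p q : Subset n) → ∁ (p Δ ∁ (p Δ q)) ≡ q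
∁-Δ-∁-Δ []      []      = refl
∁-Δ-∁-Δ (x ∷ p) (y ∷ q) = cong₂ _∷_ (bit x y) (∁-Δ-∁-Δ p q)
  where
  bit : ∀ x y → not (x xor not (x xor y)) ≡ y
  bit false false = refl
  bit false true  = refl
  bit true  false = refl
  bit true  true  = refl

∁-involutive : (p : Subset n) → ∁ (∁ p) ≡ p
∁-involutive {n} = BooleanAlgebra.¬-involutive (∪-∩-booleanAlgebra n)

∁⊥≡⊤ : ∁ ⊥ ≡ ⊤ {n}
∁⊥≡⊤ {n} = BooleanAlgebra.¬⊥≈⊤ (∪-∩-booleanAlgebra n)

_≟_ : DecidableEquality (Subset n)
_≟_ = Vec.≡-dec _≟ᵇ_

allSubsets : ∀ n → List (Subset n)
allSubsets zero    = [] ∷ []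
allSubsets (suc n) = cartesianProductWith (λ p x → x ∷ p) (allSubsets n) (outside ∷ inside ∷ [])

∈-allSubsets : (p : Subset n) → p ∈ allSubsets n
∈-allSubsets []      = Any.here refl
∈-allSubsets (x ∷ p) = ∈-cartesianProductWith⁺ (λ p x → x ∷ p) (∈-allSubsets p) (∈-sides x)
  where
  ∈-sides : ∀ x → x ∈ outside ∷ inside ∷ []
  ∈-sides outside = Any.here refl
  ∈-sides inside  = Any.there (Any.here refl)

allSubsets-unique : ∀ n → Unique (allSubsets n)
allSubsets-unique zero    = [] ∷ []
allSubsets-unique (suc n) =
  Unique.cartesianProductWith⁺ (λ p x → x ∷ p) (λ eq → Vec.∷-injectiveʳ eq , Vec.∷-injectiveˡ eq)
    (allSubsets-unique n) (((λ ()) ∷ []) ∷ [] ∷ [])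

∀-subset? : {P : Subset n → Set} → Decidable P → Dec (∀ p → P p)
∀-subset? P? = map′ (λ all p → All.lookup all (∈-allSubsets p)) (λ all → All.tabulate (λ {p} _ → all p))
  (all? P? (allSubsets _))

hasSize-filter : {P : Subset n → Set} (P? : Decidable P) → HasSize P (length (filter P? (allSubsets n)))
hasSize-filter P? = filter P? (allSubsets _) ,
  Unique.filter⁺ P? (allSubsets-unique _) ,
  (λ p p∈ → proj₂ (∈-filter⁻ P? {xs = allSubsets _} p∈)) ,
  (λ p Pp → p , ∈-filter⁺ P? (∈-allSubsets p) Pp , refl) ,
  refl

nonzeroSubsets : ∀ n → List (Subset n)
nonzeroSubsets n = filter (λ u → ¬? (u ≟ ⊥)) (allSubsets n)

module _ {A B : Set} where

  lookup-injective : {xs : List A} → Unique xs → ∀ {i j} → lookup xs i ≡ lookup xs j → i ≡ j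
  lookup-injective (_    ∷ _)      {zero}  {zero}  _  = refl
  lookup-injective (x∉xs ∷ _)      {zero}  {suc j} eq = contradiction eq (All.lookup x∉xs (∈-lookup j))
  lookup-injective (x∉xs ∷ _)      {suc i} {zero}  eq = contradiction (sym eq) (All.lookup x∉xs (∈-lookup i))
  lookup-injective (_    ∷ unique) {suc i} {suc j} eq = cong suc (lookup-injective unique eq)

  length-≤-injection : {xs : List A} {ys : List B} (f : A → B) → Unique xs →
                       (f-∈ : ∀ {x} → x ∈ xs → f x ∈ ys) →
                       (∀ {x y} → x ∈ xs → y ∈ xs → f x ≡ f y → x ≡ y) →
                       length xs ≤ length ys
  length-≤-injection {xs} {ys} f unique f-∈ f-injective = injective⇒≤ position-injective
    where
    position : Fin (length xs) → Fin (length ys)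
    position i = Any.index (f-∈ (∈-lookup i))

    position-injective : Injective _≡_ _≡_ position
    position-injective {i} {j} eq = lookup-injective unique (f-injective (∈-lookup i) (∈-lookup j)
      (SetoidMembership.index-injective (setoid B) (f-∈ (∈-lookup i)) (f-∈ (∈-lookup j)) eq))

padRight-injective : ∀ {A : Set} {m n} (m≤n : m ≤ n) (a : A) {xs ys} →
                     padRight m≤n a xs ≡ padRight m≤n a ys → xs ≡ ys
padRight-injective z≤n       _ {[]}    {[]}    _  = refl
padRight-injective (s≤s m≤n) a {_ ∷ _} {_ ∷ _} eq =
  cong₂ _∷_ (Vec.∷-injectiveˡ eq) (padRight-injective m≤n a (Vec.∷-injectiveʳ eq))

-- Unordered triples, via sorted representatives

rank : Subset n → ℕ
rank []            = 0
rank (outside ∷ p) = 2 * rank p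
rank (inside ∷ p)  = suc (2 * rank p)

rank-injective : (p q : Subset n) → rank p ≡ rank q → p ≡ q
rank-injective []            []            _  = refl
rank-injective (outside ∷ p) (outside ∷ q) eq = cong (outside ∷_) (rank-injective p q (*-cancelˡ-≡ _ _ 2 eq))
rank-injective (inside ∷ p)  (inside ∷ q)  eq =
  cong (inside ∷_) (rank-injective p q (*-cancelˡ-≡ _ _ 2 (suc-injective eq)))
rank-injective (outside ∷ p) (inside ∷ q)  eq = contradiction eq (even≢odd (rank p) (rank q))
rank-injective (inside ∷ p)  (outside ∷ q) eq = contradiction (sym eq) (even≢odd (rank q) (rank p))

Sorted₃ : Triple {n} → Set
Sorted₃ (a , b , c) = rank a < rank b × rank b < rank c

sorted₃? : Decidable (Sorted₃ {n})
sorted₃? (a , b , c) = (rank a ℕ.<? rank b) ×-dec (rank b ℕ.<? rank c)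

sameSet₃-refl : {t : Triple {n}} → SameSet₃ t t
sameSet₃-refl H = ⇔.refl

sameSet₃-trans : {s t u : Triple {n}} → SameSet₃ s t → SameSet₃ t u → SameSet₃ s u
sameSet₃-trans s≈t t≈u H = ⇔.trans (s≈t H) (t≈u H)

sameSet₃-swap₁₂ : {a b c : Subset n} → SameSet₃ (a , b , c) (b , a , c)
sameSet₃-swap₁₂ H = mk⇔ swap₁₂ swap₁₂
  where
  swap₁₂ : ∀ {a b c} → H ∈₃ (a , b , c) → H ∈₃ (b , a , c)
  swap₁₂ (inj₁ H≡a)        = inj₂ (inj₁ H≡a)
  swap₁₂ (inj₂ (inj₁ H≡b)) = inj₁ H≡b
  swap₁₂ (inj₂ (inj₂ H≡c)) = inj₂ (inj₂ H≡c)

sameSet₃-swap₂₃ : {a b c : Subset n} → SameSet₃ (a , b , c) (a , c , b)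
sameSet₃-swap₂₃ H = mk⇔ (Sum.map₂ Sum.swap) (Sum.map₂ Sum.swap)

rank-first≤ : {t : Triple {n}} {H : Subset n} → Sorted₃ t → H ∈₃ t → rank (proj₁ t) ≤ rank H
rank-first≤ _           (inj₁ refl)        = ≤-refl
rank-first≤ (a<b , _)   (inj₂ (inj₁ refl)) = <⇒≤ a<b
rank-first≤ (a<b , b<c) (inj₂ (inj₂ refl)) = <⇒≤ (<-trans a<b b<c)

rank-≤last : {t : Triple {n}} {H : Subset n} → Sorted₃ t → H ∈₃ t → rank H ≤ rank (proj₂ (proj₂ t))
rank-≤last (a<b , b<c) (inj₁ refl)        = <⇒≤ (<-trans a<b b<c)
rank-≤last (_ , b<c)   (inj₂ (inj₁ refl)) = <⇒≤ b<c
rank-≤last _           (inj₂ (inj₂ refl)) = ≤-refl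

sorted-sameSet₃⇒≡ : {s t : Triple {n}} → Sorted₃ s → Sorted₃ t → SameSet₃ s t → s ≡ t
sorted-sameSet₃⇒≡ {s = a , b , c} {t = a′ , b′ , c′} sorted-s@(a<b , b<c) sorted-t s≈t =
  cong₂ _,_ a≡a′ (cong₂ _,_ b≡b′ c≡c′)
  where
  to : ∀ {H} → H ∈₃ (a , b , c) → H ∈₃ (a′ , b′ , c′)
  to = Equivalence.to (s≈t _)

  from : ∀ {H} → H ∈₃ (a′ , b′ , c′) → H ∈₃ (a , b , c)
  from = Equivalence.from (s≈t _)

  a≡a′ : a ≡ a′
  a≡a′ = rank-injective a a′
    (≤-antisym (rank-first≤ sorted-s (from (inj₁ refl))) (rank-first≤ sorted-t (to (inj₁ refl))))

  c≡c′ : c ≡ c′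
  c≡c′ = rank-injective c c′
    (≤-antisym (rank-≤last sorted-t (to (inj₂ (inj₂ refl)))) (rank-≤last sorted-s (from (inj₂ (inj₂ refl)))))

  b≡b′ : b ≡ b′
  b≡b′ with to (inj₂ (inj₁ refl))
  ... | inj₁ b≡a′        = contradiction a<b (<-irrefl (cong rank (trans a≡a′ (sym b≡a′))))
  ... | inj₂ (inj₁ b≡b′) = b≡b′
  ... | inj₂ (inj₂ b≡c′) = contradiction b<c (<-irrefl (cong rank (trans b≡c′ (sym c≡c′))))

module _ (P : Triple {n} → Set)
         (swap₁₂ : ∀ {a b c} → P (a , b , c) → P (b , a , c))
         (swap₂₃ : ∀ {a b c} → P (a , b , c) → P (a , c , b)) where

  private
    rank-≢ : {p q : Subset n} → p ≢ q → rank p ≢ rank q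
    rank-≢ p≢q eq = p≢q (rank-injective _ _ eq)

    insert₃ : ∀ {a b c} → a ≢ c → b ≢ c → rank a < rank b → P (a , b , c) →
              ∃[ t ] Sorted₃ t × SameSet₃ (a , b , c) t × P t
    insert₃ {a} {b} {c} a≢c b≢c a<b p with <-cmp (rank b) (rank c)
    ... | tri< b<c _ _ = _ , (a<b , b<c) , sameSet₃-refl , p
    ... | tri≈ _ b=c _ = contradiction b=c (rank-≢ b≢c)
    ... | tri> _ _ c<b with <-cmp (rank a) (rank c)
    ...   | tri< a<c _ _ = _ , (a<c , c<b) , sameSet₃-swap₂₃ , swap₂₃ p
    ...   | tri≈ _ a=c _ = contradiction a=c (rank-≢ a≢c)
    ...   | tri> _ _ c<a = _ , (c<a , a<b) , sameSet₃-trans sameSet₃-swap₂₃ sameSet₃-swap₁₂ , swap₁₂ (swap₂₃ p)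

  sort₃ : ∀ {a b c} → a ≢ b → a ≢ c → b ≢ c → P (a , b , c) →
          ∃[ t ] Sorted₃ t × SameSet₃ (a , b , c) t × P t
  sort₃ {a} {b} a≢b a≢c b≢c p with <-cmp (rank a) (rank b)
  ... | tri< a<b _ _ = insert₃ a≢c b≢c a<b p
  ... | tri≈ _ a=b _ = contradiction a=b (rank-≢ a≢b)
  ... | tri> _ _ b<a with t , sorted , ≈t , pt ← insert₃ b≢c a≢c b<a (swap₁₂ p)
    = t , sorted , sameSet₃-trans sameSet₃-swap₁₂ ≈t , pt

-- Any key would make ≺₃ imply distinctness; this lexicographic one makes the
-- enumeration below increasing.
key : Triple {n} → ℕ
key {n} (a , b , c) = (rank a * 2 ^ n + rank b) * 2 ^ n + rank c

_≺₃_ : Triple {n} → Triple {n} → Set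
s ≺₃ t = Sorted₃ s × Sorted₃ t × key s < key t

_≺₃?_ : (s t : Triple {n}) → Dec (s ≺₃ t)
s ≺₃? t = sorted₃? s ×-dec sorted₃? t ×-dec (key s ℕ.<? key t)

≺₃-trans : {s t u : Triple {n}} → s ≺₃ t → t ≺₃ u → s ≺₃ u
≺₃-trans (sorted-s , _ , s<t) (_ , sorted-u , t<u) = sorted-s , sorted-u , <-trans s<t t<u

≺₃⇒¬sameSet₃ : {s t : Triple {n}} → s ≺₃ t → ¬ SameSet₃ s t
≺₃⇒¬sameSet₃ (sorted-s , sorted-t , s<t) s≈t =
  <-irrefl (cong key (sorted-sameSet₃⇒≡ sorted-s sorted-t s≈t)) s<t

module _ (lines : List (Subset n)) where

  isHyperplane? : Decidable (IsHyperplane lines)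
  isHyperplane? H = ¬? (H ≟ ⊤) ×-dec
    map′ (λ all L L∈ → All.lookup all L∈) (λ h → All.tabulate (h _))
      (all? (λ L → (L ⊆? H) ⊎-dec (∣ H ∩ L ∣ ℕ.≟ 1)) lines)

  hyperplanes : List (Subset n)
  hyperplanes = filter isHyperplane? (allSubsets n)

  ∈-hyperplanes : ∀ {H} → IsHyperplane lines H → H ∈ hyperplanes
  ∈-hyperplanes = ∈-filter⁺ isHyperplane? (∈-allSubsets _)

  VeldkampLine₃ : Triple {n} → Set
  VeldkampLine₃ (a , b , c) = IsVeldkampLine lines a b c

  veldkampLine₃? : Decidable VeldkampLine₃
  veldkampLine₃? (a , b , c) =
    isHyperplane? a ×-dec isHyperplane? b ×-dec isHyperplane? c ×-dec
    ¬? (a ≟ b) ×-dec ¬? (a ≟ c) ×-dec ¬? (b ≟ c) ×-dec (c ≟ ∁ (a Δ b))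

  veldkampLine-swap₁₂ : ∀ {a b c} → IsVeldkampLine lines a b c → IsVeldkampLine lines b a c
  veldkampLine-swap₁₂ {a} {b} (ha , hb , hc , a≢b , a≢c , b≢c , c≡) =
    hb , ha , hc , a≢b ∘ sym , b≢c , a≢c , trans c≡ (cong ∁ (Δ-comm a b))

  veldkampLine-swap₂₃ : ∀ {a b c} → IsVeldkampLine lines a b c → IsVeldkampLine lines a c b
  veldkampLine-swap₂₃ {a} {b} (ha , hb , hc , a≢b , a≢c , b≢c , refl) =
    ha , hc , hb , a≢c , a≢b , b≢c ∘ sym , sym (∁-Δ-∁-Δ a b)

  completeLine : Subset n × Subset n → Triple {n}
  completeLine (a , b) = a , b , ∁ (a Δ b)

  candidateLines : List (Triple {n})
  candidateLines = map completeLine (cartesianProduct hyperplanes hyperplanes)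

  sortedVeldkampLines : List (Triple {n})
  sortedVeldkampLines = filter (λ t → sorted₃? t ×-dec veldkampLine₃? t) candidateLines

  ∈-sortedVeldkampLines : ∀ {t} → Sorted₃ t → VeldkampLine₃ t → t ∈ sortedVeldkampLines
  ∈-sortedVeldkampLines sorted vl@(ha , hb , _ , _ , _ , _ , refl) = ∈-filter⁺ _
    (∈-map⁺ completeLine (∈-cartesianProduct⁺ (∈-hyperplanes ha) (∈-hyperplanes hb))) (sorted , vl)

  numVeldkampLines : Linked _≺₃_ sortedVeldkampLines → NumVeldkampLines lines (length sortedVeldkampLines)
  numVeldkampLines increasing = sortedVeldkampLines ,
    AllPairs.map (λ {s t} → ≺₃⇒¬sameSet₃ {s = s} {t})
      (Linked⇒AllPairs (λ {s t u} → ≺₃-trans {s = s} {t} {u}) increasing) ,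
    (λ { (a , b , c) t∈ →
      proj₂ (proj₂ (∈-filter⁻ (λ t → sorted₃? t ×-dec veldkampLine₃? t) {xs = candidateLines} t∈)) }) ,
    (λ { (a , b , c) vl → sortedRepresentative vl }) ,
    refl
    where
    sortedRepresentative : ∀ {t} → VeldkampLine₃ t → t ∈[ SameSet₃ ] sortedVeldkampLines
    sortedRepresentative vl@(_ , _ , _ , a≢b , a≢c , b≢c , _)
      with t , sorted , t≈ , vl′ ← sort₃ VeldkampLine₃ veldkampLine-swap₁₂ veldkampLine-swap₂₃ a≢b a≢c b≢c vl
      = t , ∈-sortedVeldkampLines sorted vl′ , t≈

-- Projective subspaces of the Veldkamp space

formsPG-complements : {lines : List (Subset n)} {S : Subset n → Set} {d : ℕ}
                      (emb : Subset (suc d) → Subset n) (coord : Subset n → Subset (suc d)) →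
                      (∀ u v → emb (u Δ v) ≡ emb u Δ emb v) → (∀ u → coord (emb u) ≡ u) →
                      (∀ H → S H → IsHyperplane lines H) →
                      (∀ u → u ≢ ⊥ → S (∁ (emb u))) →
                      (∀ H → S H → emb (coord (∁ H)) ≡ ∁ H) →
                      FormsPG lines d S
formsPG-complements {n} {lines} {S} {d} emb coord emb-Δ coord-emb S⇒hyperplane S-∁emb emb-coord =
  f , S-∁emb , onto , (λ u v _ _ → f-injective) , spans , spans-only
  where
  f : Subset (suc d) → Subset n
  f u = ∁ (emb u)

  f-injective : ∀ {u v} → f u ≡ f v → u ≡ v
  f-injective {u} {v} eq = begin
    u                  ≡⟨ coord-emb u ⟨
    coord (emb u)      ≡⟨ cong coord (∁-involutive (emb u)) ⟨
    coord (∁ (f u))    ≡⟨ cong (coord ∘ ∁) eq ⟩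
    coord (∁ (f v))    ≡⟨ cong coord (∁-involutive (emb v)) ⟩
    coord (emb v)      ≡⟨ coord-emb v ⟩
    v                  ∎

  f-Δ : ∀ u v → f (u Δ v) ≡ ∁ (f u Δ f v)
  f-Δ u v = cong ∁ (trans (emb-Δ u v) (sym (∁-Δ-∁ (emb u) (emb v))))

  emb-⊥ : emb ⊥ ≡ ⊥
  emb-⊥ = begin
    emb ⊥             ≡⟨ cong emb (Δ-self ⊥) ⟨
    emb (⊥ Δ ⊥)       ≡⟨ emb-Δ ⊥ ⊥ ⟩
    emb ⊥ Δ emb ⊥     ≡⟨ Δ-self (emb ⊥) ⟩
    ⊥                 ∎

  onto : ∀ H → S H → ∃[ u ] u ≢ ⊥ × f u ≡ H
  onto H SH = coord (∁ H) , coord≢⊥ , trans (cong ∁ (emb-coord H SH)) (∁-involutive H)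
    where
    coord≢⊥ : coord (∁ H) ≢ ⊥
    coord≢⊥ eq = proj₁ (S⇒hyperplane H SH) (begin
      H                      ≡⟨ ∁-involutive H ⟨
      ∁ (∁ H)                ≡⟨ cong ∁ (emb-coord H SH) ⟨
      ∁ (emb (coord (∁ H)))  ≡⟨ cong (∁ ∘ emb) eq ⟩
      ∁ (emb ⊥)              ≡⟨ cong ∁ emb-⊥ ⟩
      ∁ ⊥                    ≡⟨ ∁⊥≡⊤ ⟩
      ⊤                      ∎)

  spans : ∀ u v → u ≢ ⊥ → v ≢ ⊥ → u ≢ v → IsVeldkampLine lines (f u) (f v) (f (u Δ v))
  spans u v u≢⊥ v≢⊥ u≢v =
    S⇒hyperplane _ (S-∁emb u u≢⊥) ,
    S⇒hyperplane _ (S-∁emb v v≢⊥) ,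
    S⇒hyperplane _ (S-∁emb (u Δ v) (u≢v ∘ Δ≡⊥⇒≡ u v)) ,
    u≢v ∘ f-injective ,
    v≢⊥ ∘ ≡Δ⇒≡⊥ u v ∘ f-injective ,
    (λ eq → u≢⊥ (≡Δ⇒≡⊥ v u (trans (f-injective eq) (Δ-comm u v)))) ,
    f-Δ u v

  spans-only : ∀ u v w → u ≢ ⊥ → v ≢ ⊥ → w ≢ ⊥ → IsVeldkampLine lines (f u) (f v) (f w) → w ≡ u Δ v
  spans-only u v w _ _ _ (_ , _ , _ , _ , _ , _ , eq) = f-injective (trans eq (sym (f-Δ u v)))

formsPG-length-≤ : {lines ys : List (Subset n)} {S : Subset n → Set} {m d : ℕ} → m ≤ suc d →
                   FormsPG lines d S → (∀ {H} → S H → H ∈ ys) →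
                   length (nonzeroSubsets m) ≤ length ys
formsPG-length-≤ {m = m} m≤1+d (f , f-S , _ , f-injective , _) S⊆ys =
  length-≤-injection (f ∘ pad) (Unique.filter⁺ _ (allSubsets-unique m))
    (λ u∈ → S⊆ys (f-S _ (pad-nonzero (nonzero u∈))))
    (λ u∈ v∈ eq → padRight-injective m≤1+d outside
      (f-injective _ _ (pad-nonzero (nonzero u∈)) (pad-nonzero (nonzero v∈)) eq))
  where
  pad : Subset m → Subset _
  pad = padRight m≤1+d outside

  nonzero : ∀ {u} → u ∈ nonzeroSubsets m → u ≢ ⊥
  nonzero u∈ = proj₂ (∈-filter⁻ (λ u → ¬? (u ≟ ⊥)) {xs = allSubsets m} u∈)

  pad-nonzero : ∀ {u} → u ≢ ⊥ → pad u ≢ ⊥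
  pad-nonzero u≢⊥ eq = u≢⊥ (padRight-injective m≤1+d outside (trans eq (Vec.padRight-replicate m≤1+d outside)))

spread : (A : Subset n) → Subset ∣ ∁ A ∣ → Subset n
spread []            []      = []
spread (inside ∷ A)  u       = outside ∷ spread A u
spread (outside ∷ A) (x ∷ u) = x ∷ spread A u

restrict : (A : Subset n) → Subset n → Subset ∣ ∁ A ∣
restrict []            []      = []
restrict (inside ∷ A)  (_ ∷ p) = restrict A p
restrict (outside ∷ A) (x ∷ p) = x ∷ restrict A p

spread-Δ : (A : Subset n) (u v : Subset ∣ ∁ A ∣) → spread A (u Δ v) ≡ spread A u Δ spread A v
spread-Δ []            []      []      = refl
spread-Δ (inside ∷ A)  u       v       = cong (outside ∷_) (spread-Δ A u v)
spread-Δ (outside ∷ A) (x ∷ u) (y ∷ v) = cong (_ ∷_) (spread-Δ A u v)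

restrict-spread : (A : Subset n) (u : Subset ∣ ∁ A ∣) → restrict A (spread A u) ≡ u
restrict-spread []            []      = refl
restrict-spread (inside ∷ A)  u       = restrict-spread A u
restrict-spread (outside ∷ A) (x ∷ u) = cong (x ∷_) (restrict-spread A u)

spread-restrict-∁ : (A H : Subset n) → A ⊆ H → spread A (restrict A (∁ H)) ≡ ∁ H
spread-restrict-∁ []            []      _   = refl
spread-restrict-∁ (inside ∷ A)  (h ∷ H) A⊆H with A⊆H here
... | here = cong (outside ∷_) (spread-restrict-∁ A H (drop-∷-⊆ A⊆H))
spread-restrict-∁ (outside ∷ A) (h ∷ H) A⊆H = cong (not h ∷_) (spread-restrict-∁ A H (drop-∷-⊆ A⊆H))

hyperplaneCount : HasSize Hyp 105
hyperplaneCount = hasSize-filter (isHyperplane? D8lines)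

veldkampLineCount : NumVeldkampLines D8lines 876
veldkampLineCount = numVeldkampLines D8lines (from-yes (linked? _≺₃?_ (sortedVeldkampLines D8lines)))

hypsContaining? : (A : Subset 9) → Decidable (HypsContaining A)
hypsContaining? A H = isHyperplane? D8lines H ×-dec (A ⊆? H)

hypsContainingCount : (A : Subset 9) →
                      HasSize (HypsContaining A) (length (filter (hypsContaining? A) (allSubsets 9)))
hypsContainingCount A = hasSize-filter (hypsContaining? A)

hypsContaining-∪ : (A B H : Subset 9) → (HypsContaining A H × HypsContaining B H) ⇔ HypsContaining (A ∪ B) H
hypsContaining-∪ A B H = mk⇔
  (λ ((hyp , A⊆H) , (_ , B⊆H)) → hyp , [ A⊆H , B⊆H ]′ ∘ x∈p∪q⁻ A B)
  (λ (hyp , A∪B⊆H) → (hyp , ⊆-trans (p⊆p∪q B) A∪B⊆H) , (hyp , ⊆-trans (q⊆p∪q A B) A∪B⊆H))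

formsPG-A₂₄₆ : FormsPG D8lines 5 (HypsContaining A₂₄₆)
formsPG-A₂₄₆ = formsPG-complements (spread A₂₄₆) (restrict A₂₄₆) (spread-Δ A₂₄₆) (restrict-spread A₂₄₆)
  (λ _ → proj₁)
  (from-yes (∀-subset? λ u → ¬? (u ≟ ⊥) →-dec hypsContaining? A₂₄₆ (∁ (spread A₂₄₆ u))))
  (λ H → spread-restrict-∁ A₂₄₆ H ∘ proj₂)

formsPG-A₂₃₅₆ : FormsPG D8lines 4 (HypsContaining A₂₃₅₆)
formsPG-A₂₃₅₆ = formsPG-complements (spread A₂₃₅₆) (restrict A₂₃₅₆) (spread-Δ A₂₃₅₆) (restrict-spread A₂₃₅₆)
  (λ _ → proj₁)
  (from-yes (∀-subset? λ u → ¬? (u ≟ ⊥) →-dec hypsContaining? A₂₃₅₆ (∁ (spread A₂₃₅₆ u))))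
  (λ H → spread-restrict-∁ A₂₃₅₆ H ∘ proj₂)

formsPG-A₂₃₄₅₆ : FormsPG D8lines 3 (HypsContaining A₂₃₄₅₆)
formsPG-A₂₃₄₅₆ = formsPG-complements (spread A₂₃₄₅₆) (restrict A₂₃₄₅₆) (spread-Δ A₂₃₄₅₆) (restrict-spread A₂₃₄₅₆)
  (λ _ → proj₁)
  (from-yes (∀-subset? λ u → ¬? (u ≟ ⊥) →-dec hypsContaining? A₂₃₄₅₆ (∁ (spread A₂₃₄₅₆ u))))
  (λ H → spread-restrict-∁ A₂₃₄₅₆ H ∘ proj₂)

formsPG-dimension≤5 : ∀ (d : ℕ) (S : Subset 9 → Set) → (∀ H → S H → Hyp H) → FormsPG D8lines d S → d ≤ 5
formsPG-dimension≤5 d S S⇒Hyp pg with d ℕ.≤? 5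
... | yes d≤5 = d≤5
... | no  d≰5 = contradiction
  (formsPG-length-≤ {m = 7} (s≤s (≰⇒> d≰5)) pg (∈-hyperplanes D8lines ∘ S⇒Hyp _))
  (from-no (127 ℕ.≤? 105))

mainTheorem10 :
    HasSize Hyp 105 ×
    NumVeldkampLines D8lines 876 ×
    (HasSize (HypsContaining A₂₄₆) 63 × FormsPG D8lines 5 (HypsContaining A₂₄₆)) ×
    (∀ (d : ℕ) (S : Subset 9 → Set) → (∀ H → S H → Hyp H) → FormsPG D8lines d S → d ≤ 5) ×
    FormsPG D8lines 4 (HypsContaining A₂₃₅₆) ×
    (∀ (H : Subset 9) → (HypsContaining A₂₄₆ H × HypsContaining A₂₃₅₆ H) ⇔ HypsContaining A₂₃₄₅₆ H) ×
    HasSize (HypsContaining A₂₃₄₅₆) 15 ×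
    FormsPG D8lines 3 (HypsContaining A₂₃₄₅₆)
mainTheorem10 =
  hyperplaneCount ,
  veldkampLineCount ,
  (hypsContainingCount A₂₄₆ , formsPG-A₂₄₆) ,
  formsPG-dimension≤5 ,
  formsPG-A₂₃₅₆ ,
  hypsContaining-∪ A₂₄₆ A₂₃₅₆ ,
  hypsContainingCount A₂₃₄₅₆ ,
  formsPG-A₂₃₄₅₆
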